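{- Let $\mathcal{R}_1,\mathcal{R}_2,\mathcal{S}$ be TRSs over a signature $\mathcal{F}$ such that $\mathcal{R}_1$ is non-duplicating and $\mathcal{R}_2/\mathcal{S}$ is compatible with a strongly linear interpretation. Then $\mathrm{dc}(n,(\mathcal{R}_1\cup\mathcal{R}_2)/\mathcal{S})=O(\mathrm{dc}(n,\mathcal{R}_1/(\mathcal{R}_2\cup\mathcal{S}))+n)$.
   Context: $\to_{\mathcal{R}/\mathcal{S}}=\to_{\mathcal{S}}^*\cdot\to_{\mathcal{R}}\cdot\to_{\mathcal{S}}^*$; $\mathrm{dl}(t,\to)=\sup\{m\mid\exists u,\ t\to^mu\}$; $\mathrm{dc}(n,\mathcal{R}/\mathcal{S})=\sup\{\mathrm{dl}(t,\to_{\mathcal{R}/\mathcal{S}})\mid t\in\mathcal{T}(\mathcal{F},\mathcal{V}),|t|\le n\}$ (derivational complexity). A TRS is non-duplicating if no variable occurs more often in the right-hand side than in the left-hand side of any rule. A strongly linear interpretation (SLI) $\mathcal{M}$ interprets each $n$-ary $f\in\mathcal{F}$ as $f_{\mathcal{M}}(x_1,\dots,x_n)=x_1+\dots+x_n+c_f$ over $\mathbb{N}$ with $c_f\in\mathbb{N}$; $s>_{\mathcal{M}}t$ ($s\ge_{\mathcal{M}}t$) iff $[\alpha](s)>[\alpha](t)$ ($\ge$) for all assignments $\alpha$ into $\mathbb{N}$. $\mathcal{R}_2/\mathcal{S}$ is compatible with $\mathcal{M}$ if $l>_{\mathcal{M}}r$ for all $l\to r\in\mathcal{R}_2$ and $l\ge_{\mathcal{M}}r$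 for all $l\to r\in\mathcal{S}$. -}

module Defs where

open import Data.Nat using (ℕ; zero; suc; _+_; _*_; _≤_; _<_)
open import Data.Nat.Properties using (_≟_)
open import Data.Fin using (Fin)
open import Data.Vec using (Vec; []; _∷_; lookup; _[_]≔_)
open import Data.List using (List; _++_)
open import Data.List.Membership.Propositional using (_∈_)
open import Data.Product using (_×_; _,_; ∃; ∃-syntax; proj₁; proj₂)
open import Relation.Nullary using (yes; no)
open import Relation.Binary.PropositionalEquality using (_≡_)
open import Relation.Binary.Construct.Closure.ReflexiveTransitive using (Star)

record Signature : Set where
  field
    nsym  : ℕ
    arity : Fin nsym → ℕ
open Signature public

data Term (F : Signature) : Set where
  var : ℕ → Term F
  fun : (f : Fin (nsym F)) → Vec (Term F) (arity F f) → Term F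

module _ {F : Signature} where

  mutual
    size : Term F → ℕ
    size (var x)    = 1
    size (fun f ts) = suc (sizes ts)

    sizes : ∀ {n} → Vec (Term F) n → ℕ
    sizes []       = 0
    sizes (t ∷ ts) = size t + sizes ts

  mutual
    occ : ℕ → Term F → ℕ
    occ x (var y) with x ≟ y
    ... | yes _ = 1
    ... | no  _ = 0
    occ x (fun f ts) = occs x ts

    occs : ∀ {n} → ℕ → Vec (Term F) n → ℕ
    occs x []       = 0
    occs x (t ∷ ts) = occ x t + occs x ts

  Subst : Set
  Subst = ℕ → Term F

  mutual
    _⟨_⟩ : Term F → Subst → Term F
    var x    ⟨ σ ⟩ = σ x
    fun f ts ⟨ σ ⟩ = fun f (substs ts σ)

    substs : ∀ {n} → Vec (Term F) n → Subst → Vec (Term F) n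
    substs []       σ = []
    substs (t ∷ ts) σ = (t ⟨ σ ⟩) ∷ substs ts σ

Rule : Signature → Set
Rule F = Term F × Term F

lhs : ∀ {F} → Rule F → Term F
lhs = proj₁

rhs : ∀ {F} → Rule F → Term F
rhs = proj₂

TRS : Signature → Set
TRS F = List (Rule F)

module _ {F : Signature} where

  IsNonVar : Term F → Set
  IsNonVar t = ∃[ f ] ∃[ ts ] (t ≡ fun f ts)

  WellFormed : TRS F → Set
  WellFormed R = ∀ {ρ} → ρ ∈ R →
    IsNonVar (lhs ρ) × (∀ x → 0 < occ x (rhs ρ) → 0 < occ x (lhs ρ))

  data Step (R : TRS F) : Term F → Term F → Set where
    root : ∀ {l r} (σ : Subst) → (l , r) ∈ R → Step R (l ⟨ σ ⟩) (r ⟨ σ ⟩)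
    cong : ∀ f (ts : Vec (Term F) (arity F f)) (i : Fin (arity F f)) {u} →
           Step R (lookup ts i) u → Step R (fun f ts) (fun f (ts [ i ]≔ u))

  RelStep : TRS F → TRS F → Term F → Term F → Set
  RelStep R S s t = ∃[ a ] ∃[ b ] (Star (Step S) s a × Step R a b × Star (Step S) b t)

  data Pow (_⇒_ : Term F → Term F → Set) : ℕ → Term F → Term F → Set where
    done : ∀ {t} → Pow _⇒_ 0 t t
    more : ∀ {m s t u} → s ⇒ t → Pow _⇒_ m t u → Pow _⇒_ (suc m) s u

  -- dc(n, R/S) ≤ k, i.e. the supremum defining the derivational
  -- complexity is bounded by k:  every derivation s →^m_{R/S} u with
  -- |s| ≤ n has m ≤ k.
  DcBoundedBy : TRS F → TRS F → ℕ → ℕ → Set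
  DcBoundedBy R S n k =
    ∀ (s : Term F) → size s ≤ n → ∀ m (u : Term F) → Pow (RelStep R S) m s u → m ≤ k

  NonDuplicating : TRS F → Set
  NonDuplicating R = ∀ {ρ} → ρ ∈ R → ∀ x → occ x (rhs ρ) ≤ occ x (lhs ρ)

-- strongly linear interpretations: f(x1..xn) = x1+...+xn+c_f
SLI : Signature → Set
SLI F = Fin (nsym F) → ℕ

module _ {F : Signature} where

  mutual
    eval : SLI F → (ℕ → ℕ) → Term F → ℕ
    eval c α (var x)    = α x
    eval c α (fun f ts) = evals c α ts + c f

    evals : ∀ {n} → SLI F → (ℕ → ℕ) → Vec (Term F) n → ℕ
    evals c α []       = 0
    evals c α (t ∷ ts) = eval c α t + evals c α ts

  Compatible : SLI F → TRS F → TRS F → Set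
  Compatible c R S =
    (∀ {l r} → (l , r) ∈ R → ∀ (α : ℕ → ℕ) → eval c α r < eval c α l) ×
    (∀ {l r} → (l , r) ∈ S → ∀ (α : ℕ → ℕ) → eval c α r ≤ eval c α l)

module Submission where

-- Fix the strongly linear interpretation M
-- compatible with R₂/S and use Φ(t) = [0](t), the value of t under the
-- all-zero assignment, as a potential.
--   * An R₂-step decreases Φ by at least one, an S-step does not increase it.
--   * Since R₁ is non-duplicating, [α](r) ≤ [α](l) + [0](r) for every rule
--     l → r of R₁, so an R₁-step increases Φ by at most D, the sum of the
--     values [0](r) over the right-hand sides of R₁.
--   * Φ(s) ≤ C·|s| where C is the sum of all constants of M.
-- A (R₁∪R₂)/S-derivation of length m = i + j with i R₂-steps and j R₁-steps
-- is reorganised as a R₁/(R₂∪S)-derivation of length j (so j ≤ k), and the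
-- potential gives i ≤ Φ(s) + D·j ≤ C·n + D·k; hence m ≤ (1+C+D)(k+n).

open import Defs
open import Data.Nat using (ℕ; zero; suc; _+_; _*_; _≤_; _<_; _⊔_; z≤n; s≤s)
open import Data.Nat.Properties
open import Data.Nat.Tactic.RingSolver using (solve-∀)
open import Algebra.Properties.CommutativeSemigroup +-commutativeSemigroup
  using (interchange; xy∙z≈zy∙x; xy∙z≈xz∙y; x∙yz≈xz∙y)
open import Data.Fin using (Fin) renaming (zero to fzero; suc to fsuc)
open import Data.Vec using (Vec; []; _∷_; lookup; _[_]≔_)
open import Data.List using ([]; _∷_; _++_)
open import Data.List.Membership.Propositional using (_∈_)
open import Data.List.Membership.Propositional.Properties using (∈-++⁻; ∈-++⁺ˡ; ∈-++⁺ʳ)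
open import Data.List.Relation.Unary.Any using (here; there)
open import Data.Product using (∃; ∃-syntax; Σ-syntax; _×_; _,_; proj₁; proj₂)
open import Data.Sum using (_⊎_; inj₁; inj₂)
open import Data.Empty using (⊥-elim)
open import Relation.Nullary using (yes; no; ¬_)
open import Relation.Binary.PropositionalEquality
  using (_≡_; refl; sym; trans; cong₂; module ≡-Reasoning)
  renaming (cong to ≡-cong)
open import Relation.Binary.Construct.Closure.ReflexiveTransitive
  using (Star; ε; _◅_; _◅◅_) renaming (map to Star-map)

-- The all-zero assignment; [0](t) is the "constant part" of t.
zeroes : ℕ → ℕ
zeroes _ = 0

sumTo : ℕ → (ℕ → ℕ) → ℕ
sumTo zero    g = 0
sumTo (suc V) g = sumTo V g + g V

sumTo-cong : ∀ V {g h} → (∀ x → g x ≡ h x) → sumTo V g ≡ sumTo V h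
sumTo-cong zero    g≡h = refl
sumTo-cong (suc V) g≡h = cong₂ _+_ (sumTo-cong V g≡h) (g≡h V)

sumTo-+ : ∀ V g h → sumTo V (λ x → g x + h x) ≡ sumTo V g + sumTo V h
sumTo-+ zero    g h = refl
sumTo-+ (suc V) g h = begin
    sumTo V (λ x → g x + h x) + (g V + h V)
      ≡⟨ ≡-cong (_+ (g V + h V)) (sumTo-+ V g h) ⟩
    sumTo V g + sumTo V h + (g V + h V)
      ≡⟨ interchange (sumTo V g) (sumTo V h) (g V) (h V) ⟩
    sumTo V g + g V + (sumTo V h + h V) ∎
  where open ≡-Reasoning

sumTo-mono : ∀ V {g h} → (∀ x → g x ≤ h x) → sumTo V g ≤ sumTo V h
sumTo-mono zero    g≤h = z≤n
sumTo-mono (suc V) g≤h = +-mono-≤ (sumTo-mono V g≤h) (g≤h V)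

sumTo-zero : ∀ V → sumTo V zeroes ≡ 0
sumTo-zero zero    = refl
sumTo-zero (suc V) = ≡-cong (_+ 0) (sumTo-zero V)

sumFin : ∀ n → (Fin n → ℕ) → ℕ
sumFin zero    g = 0
sumFin (suc n) g = g fzero + sumFin n (λ i → g (fsuc i))

sumFin-≥ : ∀ n (g : Fin n → ℕ) i → g i ≤ sumFin n g
sumFin-≥ (suc n) g fzero    = m≤m+n _ _
sumFin-≥ (suc n) g (fsuc i) = ≤-trans (sumFin-≥ n (λ i → g (fsuc i)) i) (m≤n+m _ _)

module Occurrences {F : Signature} where

  occ-var-self : ∀ y → occ {F} y (var y) ≡ 1
  occ-var-self y with y ≟ y
  ... | yes _ = refl
  ... | no y≢y = ⊥-elim (y≢y refl)

  occ-var-other : ∀ x y → ¬ x ≡ y → occ {F} x (var y) ≡ 0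
  occ-var-other x y x≢y with x ≟ y
  ... | yes x≡y = ⊥-elim (x≢y x≡y)
  ... | no _ = refl

  sum-occ-var-below : ∀ V y (β : ℕ → ℕ) → V ≤ y →
    sumTo V (λ x → occ {F} x (var y) * β x) ≡ 0
  sum-occ-var-below zero    y β V≤y = refl
  sum-occ-var-below (suc V) y β V<y
    rewrite sum-occ-var-below V y β (≤-trans (n≤1+n V) V<y)
          | occ-var-other V y (λ V≡y → <-irrefl V≡y V<y) = refl

  sum-occ-var : ∀ V y (β : ℕ → ℕ) → y < V →
    sumTo V (λ x → occ {F} x (var y) * β x) ≡ β y
  sum-occ-var (suc V) y β (s≤s y≤V) with m≤n⇒m<n∨m≡n y≤V
  ... | inj₁ y<V rewrite sum-occ-var V y β y<V
                       | occ-var-other V y (λ V≡y → <-irrefl (sym V≡y) y<V) = +-identityʳ (β y)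
  ... | inj₂ refl rewrite sum-occ-var-below y y β ≤-refl
                        | occ-var-self y = +-identityʳ (β y)

  mutual
    varBound : Term F → ℕ
    varBound (var x)    = suc x
    varBound (fun f ts) = varBounds ts

    varBounds : ∀ {n} → Vec (Term F) n → ℕ
    varBounds []       = 0
    varBounds (t ∷ ts) = varBound t ⊔ varBounds ts

open Occurrences

module Interpretation {F : Signature} (M : SLI F) where

  mutual
    eval-subst : ∀ α σ (t : Term F) →
      eval M α (t ⟨ σ ⟩) ≡ eval M (λ x → eval M α (σ x)) t
    eval-subst α σ (var x)    = refl
    eval-subst α σ (fun f ts) = ≡-cong (_+ M f) (evals-subst α σ ts)

    evals-subst : ∀ {n} α σ (ts : Vec (Term F) n) →
      evals M α (substs ts σ) ≡ evals M (λ x → eval M α (σ x)) ts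
    evals-subst α σ []       = refl
    evals-subst α σ (t ∷ ts) = cong₂ _+_ (eval-subst α σ t) (evals-subst α σ ts)

  evals-update : ∀ {n} α (ts : Vec (Term F) n) i u →
    evals M α (ts [ i ]≔ u) + eval M α (lookup ts i) ≡ evals M α ts + eval M α u
  evals-update α (t ∷ ts) fzero    u = xy∙z≈zy∙x (eval M α u) (evals M α ts) (eval M α t)
  evals-update α (t ∷ ts) (fsuc i) u = begin
      eval M α t + evals M α (ts [ i ]≔ u) + eval M α (lookup ts i)
        ≡⟨ +-assoc (eval M α t) _ _ ⟩
      eval M α t + (evals M α (ts [ i ]≔ u) + eval M α (lookup ts i))
        ≡⟨ ≡-cong (eval M α t +_) (evals-update α ts i u) ⟩
      eval M α t + (evals M α ts + eval M α u)
        ≡⟨ +-assoc (eval M α t) _ _ ⟨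
      eval M α t + evals M α ts + eval M α u ∎
    where open ≡-Reasoning

  -- Linearity: [β](t) = [0](t) + Σ_{x<V} occ(x,t)·β(x) for V above the
  -- variables of t.  This is where "strongly linear" is used.
  mutual
    eval-linear : ∀ β V (t : Term F) → varBound t ≤ V →
      eval M β t ≡ eval M zeroes t + sumTo V (λ x → occ x t * β x)
    eval-linear β V (var y)    y<V = sym (sum-occ-var {F} V y β y<V)
    eval-linear β V (fun f ts) ts<V rewrite evals-linear β V ts ts<V =
      xy∙z≈xz∙y (evals M zeroes ts) (sumTo V (λ x → occs x ts * β x)) (M f)

    evals-linear : ∀ {n} β V (ts : Vec (Term F) n) → varBounds ts ≤ V →
      evals M β ts ≡ evals M zeroes ts + sumTo V (λ x → occs x ts * β x)
    evals-linear β V []       _ = sym (sumTo-zero V)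
    evals-linear β V (t ∷ ts) bound
      rewrite eval-linear β V t (m⊔n≤o⇒m≤o (varBound t) (varBounds ts) bound)
            | evals-linear β V ts (m⊔n≤o⇒n≤o (varBound t) (varBounds ts) bound)
            | sumTo-cong V (λ x → *-distribʳ-+ (β x) (occ x t) (occs x ts))
            | sumTo-+ V (λ x → occ x t * β x) (λ x → occs x ts * β x)
      = interchange (eval M zeroes t) (sumTo V (λ x → occ x t * β x))
                    (evals M zeroes ts) (sumTo V (λ x → occs x ts * β x))

  nonDuplicating-bound : ∀ (l r : Term F) → (∀ x → occ x r ≤ occ x l) → ∀ α →
    eval M α r ≤ eval M α l + eval M zeroes r
  nonDuplicating-bound l r occ-r≤occ-l α = begin
      eval M α r
        ≡⟨ eval-linear α V r (m≤n⊔m (varBound l) (varBound r)) ⟩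
      eval M zeroes r + sumTo V (λ x → occ x r * α x)
        ≤⟨ +-monoʳ-≤ (eval M zeroes r) (sumTo-mono V (λ x → *-monoˡ-≤ (α x) (occ-r≤occ-l x))) ⟩
      eval M zeroes r + sumTo V (λ x → occ x l * α x)
        ≤⟨ +-monoʳ-≤ (eval M zeroes r) (m≤n+m _ (eval M zeroes l)) ⟩
      eval M zeroes r + (eval M zeroes l + sumTo V (λ x → occ x l * α x))
        ≡⟨ ≡-cong (eval M zeroes r +_) (eval-linear α V l (m≤m⊔n (varBound l) (varBound r))) ⟨
      eval M zeroes r + eval M α l
        ≡⟨ +-comm (eval M zeroes r) (eval M α l) ⟩
      eval M α l + eval M zeroes r ∎
    where
      open ≤-Reasoning
      V = varBound l ⊔ varBound r

  -- An inequality [α](r) + a ≤ [α](l) + b valid for all rules and all α is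
  -- inherited by every rewrite step, since contexts and substitutions act
  -- additively on values.
  step-bound : ∀ (R : TRS F) a b →
    (∀ {l r} → (l , r) ∈ R → ∀ α → eval M α r + a ≤ eval M α l + b) →
    ∀ {s t} → Step R s t → ∀ α → eval M α t + a ≤ eval M α s + b
  step-bound R a b rule-bound (root {l} {r} σ l→r∈R) α
    rewrite eval-subst α σ l | eval-subst α σ r = rule-bound l→r∈R _
  step-bound R a b rule-bound (cong f ts i {u} lookup→u) α =
    +-cancelʳ-≤ (eval M α (lookup ts i)) _ _ (begin
      evals M α (ts [ i ]≔ u) + M f + a + old
        ≡⟨ ≡-cong (_+ old) (+-assoc (evals M α (ts [ i ]≔ u)) (M f) a) ⟩
      evals M α (ts [ i ]≔ u) + (M f + a) + old
        ≡⟨ xy∙z≈xz∙y (evals M α (ts [ i ]≔ u)) (M f + a) old ⟩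
      (evals M α (ts [ i ]≔ u) + old) + (M f + a)
        ≡⟨ ≡-cong (_+ (M f + a)) (evals-update α ts i u) ⟩
      (evals M α ts + new) + (M f + a)
        ≡⟨ interchange (evals M α ts) new (M f) a ⟩
      evals M α ts + M f + (new + a)
        ≤⟨ +-monoʳ-≤ (evals M α ts + M f) (step-bound R a b rule-bound lookup→u α) ⟩
      evals M α ts + M f + (old + b)
        ≡⟨ x∙yz≈xz∙y (evals M α ts + M f) old b ⟩
      evals M α ts + M f + b + old ∎)
    where
      open ≤-Reasoning
      old = eval M α (lookup ts i)
      new = eval M α u

  constantSum : ℕ
  constantSum = sumFin (nsym F) M

  mutual
    eval-zeroes-size : ∀ (t : Term F) → eval M zeroes t ≤ constantSum * size t
    eval-zeroes-size (var x)    = z≤n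
    eval-zeroes-size (fun f ts) = begin
        evals M zeroes ts + M f
          ≤⟨ +-mono-≤ (evals-zeroes-size ts) (sumFin-≥ (nsym F) M f) ⟩
        constantSum * sizes ts + constantSum
          ≡⟨ +-comm (constantSum * sizes ts) constantSum ⟩
        constantSum + constantSum * sizes ts
          ≡⟨ *-suc constantSum (sizes ts) ⟨
        constantSum * suc (sizes ts) ∎
      where open ≤-Reasoning

    evals-zeroes-size : ∀ {n} (ts : Vec (Term F) n) →
      evals M zeroes ts ≤ constantSum * sizes ts
    evals-zeroes-size []       = z≤n
    evals-zeroes-size (t ∷ ts) = begin
        eval M zeroes t + evals M zeroes ts
          ≤⟨ +-mono-≤ (eval-zeroes-size t) (evals-zeroes-size ts) ⟩
        constantSum * size t + constantSum * sizes ts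
          ≡⟨ *-distribˡ-+ constantSum (size t) (sizes ts) ⟨
        constantSum * (size t + sizes ts) ∎
      where open ≤-Reasoning

  rhsConstants : TRS F → ℕ
  rhsConstants []      = 0
  rhsConstants (ρ ∷ R) = eval M zeroes (rhs ρ) + rhsConstants R

  rhsConstants-≥ : ∀ (R : TRS F) {ρ} → ρ ∈ R → eval M zeroes (rhs ρ) ≤ rhsConstants R
  rhsConstants-≥ (ρ ∷ R) (here refl) = m≤m+n _ _
  rhsConstants-≥ (ρ ∷ R) (there ρ∈R) = ≤-trans (rhsConstants-≥ R ρ∈R) (m≤n+m _ _)

open Interpretation

module Rewriting {F : Signature} where

  step-mono : ∀ {R R′ : TRS F} → (∀ {ρ} → ρ ∈ R → ρ ∈ R′) →
    ∀ {s t} → Step R s t → Step R′ s t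
  step-mono R⊆R′ (root σ ρ∈R)           = root σ (R⊆R′ ρ∈R)
  step-mono R⊆R′ (cong f ts i inner) = cong f ts i (step-mono R⊆R′ inner)

  step-++ : ∀ (R₁ R₂ : TRS F) {s t} → Step (R₁ ++ R₂) s t → Step R₁ s t ⊎ Step R₂ s t
  step-++ R₁ R₂ (root σ ρ∈R₁R₂) with ∈-++⁻ R₁ ρ∈R₁R₂
  ... | inj₁ ρ∈R₁ = inj₁ (root σ ρ∈R₁)
  ... | inj₂ ρ∈R₂ = inj₂ (root σ ρ∈R₂)
  step-++ R₁ R₂ (cong f ts i inner) with step-++ R₁ R₂ inner
  ... | inj₁ step₁ = inj₁ (cong f ts i step₁)
  ... | inj₂ step₂ = inj₂ (cong f ts i step₂)

open Rewriting

module Counting {F : Signature} (R₁ R₂ S : TRS F) (nonDup : NonDuplicating R₁)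
                (M : SLI F) (compatible : Compatible M R₂ S) where

  Φ : Term F → ℕ
  Φ = eval M zeroes

  -- maximal growth of Φ in an R₁-step
  D : ℕ
  D = rhsConstants M R₁

  Φ-R₁ : ∀ {s t} → Step R₁ s t → Φ t ≤ Φ s + D
  Φ-R₁ {s} {t} step = m+n≤o⇒m≤o (Φ t) (step-bound M R₁ 0 D rule-bound step zeroes)
    where
      rule-bound : ∀ {l r} → (l , r) ∈ R₁ → ∀ α → eval M α r + 0 ≤ eval M α l + D
      rule-bound {l} {r} l→r∈R₁ α = begin
        eval M α r + 0            ≡⟨ +-identityʳ _ ⟩
        eval M α r                ≤⟨ nonDuplicating-bound M l r (nonDup l→r∈R₁) α ⟩
        eval M α l + Φ r          ≤⟨ +-monoʳ-≤ (eval M α l) (rhsConstants-≥ M R₁ l→r∈R₁) ⟩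
        eval M α l + D            ∎
        where open ≤-Reasoning

  Φ-R₂ : ∀ {s t} → Step R₂ s t → Φ t < Φ s
  Φ-R₂ {s} {t} step = ≤-trans (≤-reflexive (+-comm 1 (Φ t)))
    (≤-trans (step-bound M R₂ 1 0 rule-bound step zeroes) (≤-reflexive (+-identityʳ (Φ s))))
    where
      rule-bound : ∀ {l r} → (l , r) ∈ R₂ → ∀ α → eval M α r + 1 ≤ eval M α l + 0
      rule-bound l→r∈R₂ α = ≤-trans (≤-reflexive (+-comm _ 1))
        (≤-trans (proj₁ compatible l→r∈R₂ α) (≤-reflexive (sym (+-identityʳ _))))

  Φ-S : ∀ {s t} → Step S s t → Φ t ≤ Φ s
  Φ-S step = +-cancelʳ-≤ 0 _ _ (step-bound M S 0 0 rule-bound step zeroes)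
    where
      rule-bound : ∀ {l r} → (l , r) ∈ S → ∀ α → eval M α r + 0 ≤ eval M α l + 0
      rule-bound l→r∈S α = +-monoˡ-≤ 0 (proj₂ compatible l→r∈S α)

  Φ-S* : ∀ {s t} → Star (Step S) s t → Φ t ≤ Φ s
  Φ-S* ε               = ≤-refl
  Φ-S* (step ◅ steps) = ≤-trans (Φ-S* steps) (Φ-S step)

  Φ-rel-R₁ : ∀ {s a b t} → Star (Step S) s a → Step R₁ a b → Star (Step S) b t →
    Φ t ≤ Φ s + D
  Φ-rel-R₁ s→a a→b b→t =
    ≤-trans (Φ-S* b→t) (≤-trans (Φ-R₁ a→b) (+-monoˡ-≤ D (Φ-S* s→a)))

  Φ-rel-R₂ : ∀ {s a b t} → Star (Step S) s a → Step R₂ a b → Star (Step S) b t →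
    Φ t < Φ s
  Φ-rel-R₂ s→a a→b b→t =
    <-≤-trans (≤-<-trans (Φ-S* b→t) (Φ-R₂ a→b)) (Φ-S* s→a)

  S⊆R₂S : ∀ {s t} → Star (Step S) s t → Star (Step (R₂ ++ S)) s t
  S⊆R₂S = Star-map (step-mono (∈-++⁺ʳ R₂))

  R₁Steps : ℕ → Term F → Term F → Set
  R₁Steps j s u =
    ∃[ w ] (Star (Step (R₂ ++ S)) s w × Pow (RelStep R₁ (R₂ ++ S)) j w u)

  split : ∀ {m s u} → Pow (RelStep (R₁ ++ R₂) S) m s u →
    ∃[ i ] ∃[ j ] (m ≡ i + j × Φ u + i ≤ Φ s + D * j × R₁Steps j s u)
  split {s = s} done =
    0 , 0 , refl , ≤-reflexive (≡-cong (Φ s +_) (sym (*-zeroʳ D))) , s , ε , done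
  split {s = s} {u} (more {t = t} (a , b , s→a , a→b , b→t) rest)
    with split rest | step-++ R₁ R₂ a→b
  ... | i , j , m≡i+j , invariant , w , t→w , w→u | inj₁ a→₁b =
    i , suc j , trans (≡-cong suc m≡i+j) (sym (+-suc i j)) , invariant′ , s , ε ,
    more (a , b , S⊆R₂S s→a , a→₁b , S⊆R₂S b→t ◅◅ t→w) w→u
    where
      open ≤-Reasoning
      invariant′ : Φ u + i ≤ Φ s + D * suc j
      invariant′ = begin
        Φ u + i         ≤⟨ invariant ⟩
        Φ t + D * j     ≤⟨ +-monoˡ-≤ (D * j) (Φ-rel-R₁ s→a a→₁b b→t) ⟩
        Φ s + D + D * j ≡⟨ +-assoc (Φ s) D (D * j) ⟩
        Φ s + (D + D * j) ≡⟨ ≡-cong (Φ s +_) (*-suc D j) ⟨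
        Φ s + D * suc j ∎
  ... | i , j , m≡i+j , invariant , w , t→w , w→u | inj₂ a→₂b =
    suc i , j , ≡-cong suc m≡i+j , invariant′ , w ,
    S⊆R₂S s→a ◅◅ (step-mono ∈-++⁺ˡ a→₂b ◅ (S⊆R₂S b→t ◅◅ t→w)) , w→u
    where
      open ≤-Reasoning
      invariant′ : Φ u + suc i ≤ Φ s + D * j
      invariant′ = begin
        Φ u + suc i       ≡⟨ +-suc (Φ u) i ⟩
        suc (Φ u + i)     ≤⟨ s≤s invariant ⟩
        suc (Φ t) + D * j ≤⟨ +-monoˡ-≤ (D * j) (Φ-rel-R₂ s→a a→₂b b→t) ⟩
        Φ s + D * j       ∎

  R₁Steps-bound : ∀ n k → DcBoundedBy R₁ (R₂ ++ S) n k →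
    ∀ {j s u} → size s ≤ n → R₁Steps j s u → j ≤ k
  R₁Steps-bound n k dc≤k {zero}  _   _ = z≤n
  R₁Steps-bound n k dc≤k {suc j} {s} {u} |s|≤n
    (w , s→w , more (a , b , w→a , a→b , b→t) rest) =
    dc≤k s |s|≤n (suc j) u (more (a , b , s→w ◅◅ w→a , a→b , b→t) rest)

  C : ℕ
  C = constantSum {F} M

  expand : ∀ C D k n → suc (C + D) * (k + n) ≡ C * n + D * k + k + (n + C * k + D * n)
  expand = solve-∀

  dc-bound : ∀ n k → DcBoundedBy R₁ (R₂ ++ S) n k →
    DcBoundedBy (R₁ ++ R₂) S n (suc (C + D) * (k + n))
  dc-bound n k dc≤k s |s|≤n m u derivation
    with split derivation
  ... | i , j , m≡i+j , invariant , r₁Steps = begin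
      m                               ≡⟨ m≡i+j ⟩
      i + j                           ≤⟨ +-mono-≤ i≤Cn+Dk j≤k ⟩
      C * n + D * k + k               ≤⟨ m≤m+n _ _ ⟩
      C * n + D * k + k + (n + C * k + D * n) ≡⟨ expand C D k n ⟨
      suc (C + D) * (k + n)           ∎
    where
      open ≤-Reasoning
      j≤k = R₁Steps-bound n k dc≤k |s|≤n r₁Steps
      i≤Cn+Dk : i ≤ C * n + D * k
      i≤Cn+Dk = begin
        i               ≤⟨ m≤n+m i (Φ u) ⟩
        Φ u + i         ≤⟨ invariant ⟩
        Φ s + D * j     ≤⟨ +-mono-≤ (eval-zeroes-size M s) (*-monoʳ-≤ D j≤k) ⟩
        C * size s + D * k ≤⟨ +-monoˡ-≤ (D * k) (*-monoʳ-≤ C |s|≤n) ⟩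
        C * n + D * k   ∎

corollary4p7 : (F : Signature) (R₁ R₂ S : TRS F) →
    WellFormed R₁ → WellFormed R₂ → WellFormed S →
    NonDuplicating R₁ →
    Σ[ M ∈ SLI F ] Compatible M R₂ S →
    ∃[ c ] ∃[ N ] (∀ n k → N ≤ n →
    DcBoundedBy R₁ (R₂ ++ S) n k →
    DcBoundedBy (R₁ ++ R₂) S n (c * (k + n)))
corollary4p7 F R₁ R₂ S _ _ _ nonDup (M , compatible) =
  suc (C + D) , 0 , λ n k _ → dc-bound n k
  where open Counting R₁ R₂ S nonDup M compatible
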